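{- Let $q$ be a prime power, $r\in\mathbb{F}_{q^2}\setminus\mathbb{F}_q$ and $b\in\mathbb{F}_{q^2}^*$, and let \[ f(X)=X+\frac{b}{X-r}+\frac{b^q}{X-r^q}\in\mathbb{F}_q(X). \] If $f$ is a permutation rational function of $\mathbb{P}^1(\mathbb{F}_q)$, then $b\in\mathbb{F}_q^*$.
   Context: $\mathbb{P}^1(\mathbb{F}_q)=\mathbb{F}_q\cup\{\infty\}$ is the projective line over $\mathbb{F}_q$. A rational function $f=P/Q\in\mathbb{F}_q(X)$ ($P,Q\in\mathbb{F}_q[X]$ coprime) defines a map $\mathbb{P}^1(\mathbb{F}_q)\to\mathbb{P}^1(\mathbb{F}_q)$ in the usual way (zeros of $Q$ map to $\infty$, and $f(\infty)$ is the limiting value). A permutation rational function of $\mathbb{P}^1(\mathbb{F}_q)$ is a rational function whose induced map on $\mathbb{P}^1(\mathbb{F}_q)$ is a bijection. -}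

module Defs where

open import Level using (0ℓ)
open import Data.Nat using (ℕ; zero; suc; _^_; _≥_)
open import Data.Nat.Primality using (Prime)
open import Data.Fin using (Fin)
open import Data.Unit using (⊤)
open import Data.Maybe using (Maybe; just; nothing)
open import Data.Product using (Σ; ∃; _×_; _,_)
open import Relation.Nullary using (¬_; Dec; yes; no)
open import Relation.Binary.PropositionalEquality using (_≡_)
open import Algebra.Structures using (IsCommutativeRing)
open import Function.Bundles using (_↔_)

IsPrimePower : ℕ → Set
IsPrimePower q = Σ ℕ λ p → Σ ℕ λ n → Prime p × n ≥ 1 × q ≡ p ^ n

record Field : Set₁ where
  infixl 6 _+_ _-_
  infixl 7 _*_
  field
    Carrier : Set
    _+_ _*_ : Carrier → Carrier → Carrier
    -_ : Carrier → Carrier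
    0# 1# : Carrier
    _⁻¹ : Carrier → Carrier
    isCommutativeRing : IsCommutativeRing _≡_ _+_ _*_ -_ 0# 1#
    0≢1 : ¬ (0# ≡ 1#)
    inverseʳ : ∀ x → ¬ (x ≡ 0#) → x * (x ⁻¹) ≡ 1#
    _≟_ : (x y : Carrier) → Dec (x ≡ y)

  _-_ : Carrier → Carrier → Carrier
  x - y = x + (- y)

  _^′_ : Carrier → ℕ → Carrier
  x ^′ zero = 1#
  x ^′ suc n = x * (x ^′ n)

module _ (K : Field) where
  open Field K

  HasCard : ℕ → Set
  HasCard m = Fin m ↔ Carrier

  -- When |K| = q^2, the subfield F_q is { x ∈ K | x^q = x }.
  InFq : ℕ → Carrier → Set
  InFq q x = x ^′ q ≡ x

  -- P^1(K) = K ∪ {∞}, with ∞ represented by nothing.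
  P1 : Set
  P1 = Maybe Carrier

  InP1Fq : ℕ → P1 → Set
  InP1Fq q nothing  = ⊤
  InP1Fq q (just x) = InFq q x

  -- The map induced on P^1(K) by
  --   f(X) = X + b/(X - r) + b^q/(X - r^q),
  -- for r ∉ F_q, b ≠ 0: the poles of f are exactly r and r^q (they are
  -- distinct and do not cancel since b ≠ 0), and f(∞) = ∞ since the
  -- reduced numerator has degree 3 and the denominator degree 2.
  fMap : ℕ → Carrier → Carrier → P1 → P1
  fMap q r b nothing = nothing
  fMap q r b (just x) with x ≟ r | x ≟ (r ^′ q)
  ... | yes _ | _     = nothing
  ... | no _  | yes _ = nothing
  ... | no _  | no _  =
        just (x + b * ((x - r) ⁻¹) + (b ^′ q) * ((x - (r ^′ q)) ⁻¹))

  IsPermutationP1Fq : ℕ → (P1 → P1) → Set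
  IsPermutationP1Fq q g =
      (∀ P → InP1Fq q P → InP1Fq q (g P))
    × (∀ P Q → InP1Fq q P → InP1Fq q Q → g P ≡ g Q → P ≡ Q)
    × (∀ Q → InP1Fq q Q → ∃ λ P → InP1Fq q P × g P ≡ Q)

module Submission where

-- Write S(F) = Σ_{x ∈ F_q} F(x).  Since f fixes ∞ it permutes F_q,
-- so S(f) = S(id), i.e.  b·T(r) + b^q·T(r^q) = 0  with  T(ρ) = S(x ↦ 1/(x-ρ)).
-- The Möbius substitution x ↦ (ρ + ρ') - ρρ'/x permutes F_q when ρ + ρ' and
-- ρρ' lie in F_q, and it yields  T(ρ)·(ρ' - ρ) = 1.  Applied to (r, r^q) and
-- to (r^q, r) this turns the relation into  b - b^q = 0.

open import Defs
open import Level using (0ℓ)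
open import Data.Nat as ℕ using (ℕ; zero; suc; _^_)
import Data.Nat.Properties as ℕP
open import Data.Integer as ℤ using (ℤ; -[1+_]; _⊖_)
import Data.Integer.Properties as ℤP
open import Data.Sign as Sign using (Sign)
open import Data.Fin as Fin using (Fin)
open import Data.Maybe using (Maybe; just; nothing)
open import Data.Maybe.Properties using (just-injective)
open import Data.Product using (Σ; ∃; _×_; _,_; proj₁; proj₂)
open import Data.Sum using (_⊎_; inj₁; inj₂)
open import Data.Empty using (⊥-elim)
open import Function using (_∘_; id)
open import Function.Bundles using (_↔_; Inverse)
open import Relation.Nullary using (¬_; Dec; yes; no)
open import Data.Nat.Primality using (Prime; prime⇒nonZero)
open import Relation.Binary.PropositionalEquality
open import Axiom.UniquenessOfIdentityProofs using (module Decidable⇒UIP)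
open import Algebra.Bundles using (CommutativeRing; CommutativeMonoid)
open import Algebra.Solver.Ring.AlmostCommutativeRing
  using (AlmostCommutativeRing; fromCommutativeRing; _-Raw-AlmostCommutative⟶_)

module FieldArithmetic (K : Field) where
  open Field K
  open ≡-Reasoning

  commutativeRing : CommutativeRing 0ℓ 0ℓ
  commutativeRing = record { isCommutativeRing = isCommutativeRing }

  open CommutativeRing commutativeRing public
    using ( +-assoc; +-comm; +-identityˡ; +-identityʳ; -‿inverseʳ
          ; *-assoc; *-comm; *-identityˡ; *-identityʳ; zeroˡ; zeroʳ
          ; ring; semiring; commutativeSemiring
          ; +-commutativeMonoid; *-commutativeMonoid )
  open import Algebra.Properties.Ring ring public
    using (-‿distribˡ-*; -‿distribʳ-*; -‿involutive; -‿+-comm; -0#≈0#; +-cancelˡ; +-cancelʳ; +-inverseʳ-unique; x∙y⁻¹≈ε⇒x≈y)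
  open import Algebra.Properties.Semiring.Mult semiring public
    using (×1-homo-*) renaming (_×_ to _·_; ×-homo-+ to ·-homo-+)

  -- The ring solver normalises with integer coefficients, so it needs the
  -- canonical ring map ℤ → K, i ↦ ±(|i|·1), and the fact that it is a homomorphism.
  sign-apply : Sign → Carrier → Carrier
  sign-apply Sign.+ x = x
  sign-apply Sign.- x = - x

  ⟦_⟧ℤ : ℤ → Carrier
  ⟦ i ⟧ℤ = sign-apply (ℤ.sign i) (ℤ.∣ i ∣ · 1#)

  ◃-homo : ∀ s n → ⟦ s ℤ.◃ n ⟧ℤ ≡ sign-apply s (n · 1#)
  ◃-homo Sign.+ zero    = refl
  ◃-homo Sign.- zero    = sym -0#≈0#
  ◃-homo Sign.+ (suc n) = refl
  ◃-homo Sign.- (suc n) = refl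

  sign-apply-* : ∀ s t x y → sign-apply (s Sign.* t) (x * y) ≡ sign-apply s x * sign-apply t y
  sign-apply-* Sign.+ Sign.+ x y = refl
  sign-apply-* Sign.+ Sign.- x y = -‿distribʳ-* x y
  sign-apply-* Sign.- Sign.+ x y = -‿distribˡ-* x y
  sign-apply-* Sign.- Sign.- x y = begin
    x * y             ≡⟨ cong (_* y) (sym (-‿involutive x)) ⟩
    - (- x) * y       ≡⟨ sym (-‿distribˡ-* (- x) y) ⟩
    - (- x * y)       ≡⟨ -‿distribʳ-* (- x) y ⟩
    - x * - y         ∎

  ℤ-*-homo : ∀ i j → ⟦ i ℤ.* j ⟧ℤ ≡ ⟦ i ⟧ℤ * ⟦ j ⟧ℤ
  ℤ-*-homo i j = begin
    ⟦ i ℤ.* j ⟧ℤ                                          ≡⟨ ◃-homo s (ℤ.∣ i ∣ ℕ.* ℤ.∣ j ∣) ⟩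
    sign-apply s ((ℤ.∣ i ∣ ℕ.* ℤ.∣ j ∣) · 1#)             ≡⟨ cong (sign-apply s) (×1-homo-* ℤ.∣ i ∣ ℤ.∣ j ∣) ⟩
    sign-apply s ((ℤ.∣ i ∣ · 1#) * (ℤ.∣ j ∣ · 1#))        ≡⟨ sign-apply-* (ℤ.sign i) (ℤ.sign j) _ _ ⟩
    ⟦ i ⟧ℤ * ⟦ j ⟧ℤ                                       ∎
    where s = ℤ.sign i Sign.* ℤ.sign j

  ⊖-homo : ∀ m n → ⟦ m ⊖ n ⟧ℤ ≡ m · 1# - n · 1#
  ⊖-homo m       zero    = sym (trans (cong ((m · 1#) +_) -0#≈0#) (+-identityʳ _))
  ⊖-homo zero    (suc n) = sym (+-identityˡ _)
  ⊖-homo (suc m) (suc n) = begin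
    ⟦ suc m ⊖ suc n ⟧ℤ                        ≡⟨ cong ⟦_⟧ℤ (ℤP.[1+m]⊖[1+n]≡m⊖n m n) ⟩
    ⟦ m ⊖ n ⟧ℤ                                ≡⟨ ⊖-homo m n ⟩
    m · 1# - n · 1#                           ≡⟨ cong ((m · 1#) +_) (sym (+-identityˡ _)) ⟩
    m · 1# + (0# + - (n · 1#))                ≡⟨ cong (λ z → m · 1# + (z + - (n · 1#))) (sym (-‿inverseʳ 1#)) ⟩
    m · 1# + ((1# + - 1#) + - (n · 1#))       ≡⟨ shuffle (m · 1#) (n · 1#) ⟩
    (1# + m · 1#) - (1# + n · 1#)             ∎
    where
    shuffle : ∀ a c → a + ((1# + - 1#) + - c) ≡ (1# + a) - (1# + c)
    shuffle a c = begin
      a + ((1# + - 1#) + - c)     ≡⟨ sym (+-assoc a _ _) ⟩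
      (a + (1# + - 1#)) + - c     ≡⟨ cong (_+ - c) (trans (sym (+-assoc a 1# _)) (cong (_+ - 1#) (+-comm a 1#))) ⟩
      ((1# + a) + - 1#) + - c     ≡⟨ +-assoc (1# + a) _ _ ⟩
      (1# + a) + (- 1# + - c)     ≡⟨ cong ((1# + a) +_) (-‿+-comm 1# c) ⟩
      (1# + a) - (1# + c)         ∎

  ℤ-+-homo : ∀ i j → ⟦ i ℤ.+ j ⟧ℤ ≡ ⟦ i ⟧ℤ + ⟦ j ⟧ℤ
  ℤ-+-homo -[1+ m ] -[1+ n ] = begin
    - (suc (suc (m ℕ.+ n)) · 1#)            ≡⟨ cong -_ (trans (cong (_· 1#) (sym (ℕP.+-suc (suc m) n))) (·-homo-+ 1# (suc m) (suc n))) ⟩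
    - (suc m · 1# + suc n · 1#)             ≡⟨ sym (-‿+-comm _ _) ⟩
    - (suc m · 1#) + - (suc n · 1#)         ∎
  ℤ-+-homo -[1+ m ] (ℤ.+ n)  = trans (⊖-homo n (suc m)) (+-comm _ _)
  ℤ-+-homo (ℤ.+ m)  -[1+ n ] = ⊖-homo m (suc n)
  ℤ-+-homo (ℤ.+ m)  (ℤ.+ n)  = ·-homo-+ 1# m n

  ℤ-neg-homo : ∀ i → ⟦ ℤ.- i ⟧ℤ ≡ - ⟦ i ⟧ℤ
  ℤ-neg-homo -[1+ n ]      = sym (-‿involutive _)
  ℤ-neg-homo (ℤ.+ zero)    = sym -0#≈0#
  ℤ-neg-homo (ℤ.+ (suc n)) = refl

  ℤ-homomorphism : ℤ.+-*-rawRing -Raw-AlmostCommutative⟶ fromCommutativeRing commutativeRing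
  ℤ-homomorphism = record
    { ⟦_⟧ = ⟦_⟧ℤ ; +-homo = ℤ-+-homo ; *-homo = ℤ-*-homo ; -‿homo = ℤ-neg-homo
    ; 0-homo = refl ; 1-homo = +-identityʳ 1# }

  ℤ-equal? : ∀ i j → Maybe (⟦ i ⟧ℤ ≡ ⟦ j ⟧ℤ)
  ℤ-equal? i j with i ℤ.≟ j
  ... | yes i≡j = just (cong ⟦_⟧ℤ i≡j)
  ... | no _    = nothing

  open import Algebra.Solver.Ring ℤ.+-*-rawRing (fromCommutativeRing commutativeRing)
    ℤ-homomorphism ℤ-equal? public
    using (solve; _:=_; _:+_; _:*_; :-_; _:-_)

  inverseˡ : ∀ x → ¬ x ≡ 0# → x ⁻¹ * x ≡ 1#
  inverseˡ x x≢0 = trans (*-comm (x ⁻¹) x) (inverseʳ x x≢0)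

  nonzero-of-unit : ∀ x y → x * y ≡ 1# → ¬ x ≡ 0#
  nonzero-of-unit x y xy≡1 x≡0 = 0≢1 (begin
    0#      ≡⟨ sym (zeroˡ y) ⟩
    0# * y  ≡⟨ cong (_* y) (sym x≡0) ⟩
    x * y   ≡⟨ xy≡1 ⟩
    1#      ∎)

  *-cancelˡ : ∀ a x y → ¬ a ≡ 0# → a * x ≡ a * y → x ≡ y
  *-cancelˡ a x y a≢0 ax≡ay = begin
    x                 ≡⟨ sym (*-identityˡ x) ⟩
    1# * x            ≡⟨ cong (_* x) (sym (inverseˡ a a≢0)) ⟩
    (a ⁻¹ * a) * x    ≡⟨ *-assoc (a ⁻¹) a x ⟩
    a ⁻¹ * (a * x)    ≡⟨ cong (a ⁻¹ *_) ax≡ay ⟩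
    a ⁻¹ * (a * y)    ≡⟨ sym (*-assoc (a ⁻¹) a y) ⟩
    (a ⁻¹ * a) * y    ≡⟨ cong (_* y) (inverseˡ a a≢0) ⟩
    1# * y            ≡⟨ *-identityˡ y ⟩
    y                 ∎

  inverse-unique : ∀ x y → x * y ≡ 1# → y ≡ x ⁻¹
  inverse-unique x y xy≡1 = *-cancelˡ x y (x ⁻¹) x≢0 (trans xy≡1 (sym (inverseʳ x x≢0)))
    where x≢0 = nonzero-of-unit x y xy≡1

  zero-product : ∀ a b → a * b ≡ 0# → a ≡ 0# ⊎ b ≡ 0#
  zero-product a b ab≡0 with a ≟ 0#
  ... | yes a≡0 = inj₁ a≡0
  ... | no  a≢0 = inj₂ (*-cancelˡ a b 0# a≢0 (trans ab≡0 (sym (zeroʳ a))))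

  *-nonzero : ∀ a b → ¬ a ≡ 0# → ¬ b ≡ 0# → ¬ a * b ≡ 0#
  *-nonzero a b a≢0 b≢0 ab≡0 with zero-product a b ab≡0
  ... | inj₁ a≡0 = a≢0 a≡0
  ... | inj₂ b≡0 = b≢0 b≡0

  ⁻¹-nonzero : ∀ x → ¬ x ≡ 0# → ¬ x ⁻¹ ≡ 0#
  ⁻¹-nonzero x x≢0 = nonzero-of-unit (x ⁻¹) x (inverseˡ x x≢0)

  ⁻¹-involutive : ∀ x → ¬ x ≡ 0# → (x ⁻¹) ⁻¹ ≡ x
  ⁻¹-involutive x x≢0 = sym (inverse-unique (x ⁻¹) x (inverseˡ x x≢0))

  ⁻¹-* : ∀ x y → ¬ x ≡ 0# → ¬ y ≡ 0# → (x * y) ⁻¹ ≡ x ⁻¹ * y ⁻¹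
  ⁻¹-* x y x≢0 y≢0 = sym (inverse-unique (x * y) (x ⁻¹ * y ⁻¹) (begin
    (x * y) * (x ⁻¹ * y ⁻¹)    ≡⟨ solve 4 (λ a b c d → (a :* b) :* (c :* d) := (a :* c) :* (b :* d)) refl x y (x ⁻¹) (y ⁻¹) ⟩
    (x * x ⁻¹) * (y * y ⁻¹)    ≡⟨ cong₂ _*_ (inverseʳ x x≢0) (inverseʳ y y≢0) ⟩
    1# * 1#                    ≡⟨ *-identityˡ 1# ⟩
    1#                         ∎))

  ⁻¹-neg : ∀ x → ¬ x ≡ 0# → (- x) ⁻¹ ≡ - (x ⁻¹)
  ⁻¹-neg x x≢0 = sym (inverse-unique (- x) (- (x ⁻¹)) (begin
    - x * - (x ⁻¹)   ≡⟨ solve 2 (λ a b → (:- a) :* (:- b) := a :* b) refl x (x ⁻¹) ⟩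
    x * x ⁻¹         ≡⟨ inverseʳ x x≢0 ⟩
    1#               ∎))

  *-⁻¹-cancel : ∀ a w → ¬ a ≡ 0# → ¬ w ≡ 0# → a * (a * w) ⁻¹ ≡ w ⁻¹
  *-⁻¹-cancel a w a≢0 w≢0 = begin
    a * (a * w) ⁻¹        ≡⟨ cong (a *_) (⁻¹-* a w a≢0 w≢0) ⟩
    a * (a ⁻¹ * w ⁻¹)     ≡⟨ sym (*-assoc a (a ⁻¹) (w ⁻¹)) ⟩
    (a * a ⁻¹) * w ⁻¹     ≡⟨ cong (_* w ⁻¹) (inverseʳ a a≢0) ⟩
    1# * w ⁻¹             ≡⟨ *-identityˡ (w ⁻¹) ⟩
    w ⁻¹                  ∎

  ^-+ : ∀ x m n → x ^′ (m ℕ.+ n) ≡ x ^′ m * x ^′ n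
  ^-+ x zero    n = sym (*-identityˡ _)
  ^-+ x (suc m) n = trans (cong (x *_) (^-+ x m n)) (sym (*-assoc x _ _))

  ^-* : ∀ x m n → x ^′ (m ℕ.* n) ≡ (x ^′ m) ^′ n
  ^-* x m zero    = cong (x ^′_) (ℕP.*-zeroʳ m)
  ^-* x m (suc n) = begin
    x ^′ (m ℕ.* suc n)          ≡⟨ cong (x ^′_) (ℕP.*-suc m n) ⟩
    x ^′ (m ℕ.+ m ℕ.* n)        ≡⟨ ^-+ x m (m ℕ.* n) ⟩
    x ^′ m * x ^′ (m ℕ.* n)     ≡⟨ cong (x ^′ m *_) (^-* x m n) ⟩
    x ^′ m * (x ^′ m) ^′ n      ∎

  *-^ : ∀ x y n → (x * y) ^′ n ≡ x ^′ n * y ^′ n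
  *-^ x y zero    = sym (*-identityˡ 1#)
  *-^ x y (suc n) = trans (cong ((x * y) *_) (*-^ x y n))
    (solve 4 (λ a b c d → (a :* b) :* (c :* d) := (a :* c) :* (b :* d)) refl x y _ _)

  1-^ : ∀ n → 1# ^′ n ≡ 1#
  1-^ zero    = refl
  1-^ (suc n) = trans (*-identityˡ _) (1-^ n)

  ^-zero : ∀ x n → x ^′ n ≡ 0# → x ≡ 0#
  ^-zero x zero    1≡0 = ⊥-elim (0≢1 (sym 1≡0))
  ^-zero x (suc n) xⁿ⁺¹≡0 with zero-product x (x ^′ n) xⁿ⁺¹≡0
  ... | inj₁ x≡0  = x≡0
  ... | inj₂ xⁿ≡0 = ^-zero x n xⁿ≡0

  ·1-^ : ∀ m n → (m ^ n) · 1# ≡ (m · 1#) ^′ n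
  ·1-^ m zero    = +-identityʳ 1#
  ·1-^ m (suc n) = trans (×1-homo-* m (m ^ n)) (cong ((m · 1#) *_) (·1-^ m n))

  ifZero : Carrier → Carrier → Carrier → Carrier
  ifZero x z w with x ≟ 0#
  ... | yes _ = z
  ... | no  _ = w

  ifZero-yes : ∀ {x} z w → x ≡ 0# → ifZero x z w ≡ z
  ifZero-yes {x} z w x≡0 with x ≟ 0#
  ... | yes _   = refl
  ... | no  x≢0 = ⊥-elim (x≢0 x≡0)

  ifZero-no : ∀ {x} z w → ¬ x ≡ 0# → ifZero x z w ≡ w
  ifZero-no {x} z w x≢0 with x ≟ 0#
  ... | yes x≡0 = ⊥-elim (x≢0 x≡0)
  ... | no  _   = refl

module FiniteSum {A : Set} (M : CommutativeMonoid 0ℓ 0ℓ) (N : ℕ) (e : Fin (suc N) ↔ A) where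
  open CommutativeMonoid M using (Carrier; _≈_; _∙_; ε; ∙-cong; monoid)
    renaming (sym to ≈-sym; trans to ≈-trans; reflexive to ≈-reflexive)
  open import Algebra.Properties.CommutativeMonoid.Sum M
    using (sum; sum-cong-≋; sum-cong-≗; sum-permute; ∑-distrib-+; sum-remove; sum-replicate)
  open import Algebra.Properties.Monoid.Mult monoid public using () renaming (_×_ to _·_)
  open import Data.Fin using (punchIn)
  open import Data.Fin.Properties using (punchInᵢ≢i)
  open import Data.Fin.Permutation using (Permutation; permutation)
  open Inverse e using (to; from; strictlyInverseˡ; strictlyInverseʳ)

  Σ[_] : (A → Carrier) → Carrier
  Σ[ F ] = sum (F ∘ to)

  Σ-cong : ∀ {F G : A → Carrier} → (∀ x → F x ≈ G x) → Σ[ F ] ≈ Σ[ G ]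
  Σ-cong F≈G = sum-cong-≋ (F≈G ∘ to)

  Σ-∙ : ∀ (F G : A → Carrier) → Σ[ (λ x → F x ∙ G x) ] ≈ Σ[ F ] ∙ Σ[ G ]
  Σ-∙ F G = ∑-distrib-+ (F ∘ to) (G ∘ to)

  Σ-reindex : (σ τ : A → A) → (∀ x → τ (σ x) ≡ x) → (∀ y → σ (τ y) ≡ y)
            → ∀ F → Σ[ F ∘ σ ] ≈ Σ[ F ]
  Σ-reindex σ τ τσ στ F = ≈-sym (≈-trans (sum-permute (F ∘ to) π)
                                         (≈-reflexive (sum-cong-≗ (cong F ∘ strictlyInverseˡ ∘ σ ∘ to))))
    where
    conjugate : (A → A) → Fin (suc N) → Fin (suc N)
    conjugate g = from ∘ g ∘ to
    conjugate-inverse : ∀ g h → (∀ y → g (h y) ≡ y) → ∀ k → conjugate g (conjugate h k) ≡ k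
    conjugate-inverse g h gh k = trans (cong (from ∘ g) (strictlyInverseˡ (h (to k))))
                                       (trans (cong from (gh (to k))) (strictlyInverseʳ k))
    π : Permutation (suc N) (suc N)
    π = permutation (conjugate σ) (conjugate τ) (conjugate-inverse σ τ στ) (conjugate-inverse τ σ τσ)

  Σ-single : (a : A) (c : Carrier) (F : A → Carrier) → (∀ x → ¬ x ≡ a → F x ≈ c)
           → Σ[ F ] ≈ F a ∙ (N · c)
  Σ-single a c F F≈c = ≈-trans (sum-remove {i = from a} (F ∘ to))
    (∙-cong (≈-reflexive (cong F (strictlyInverseˡ a)))
            (≈-trans (sum-cong-≋ (λ j → F≈c _ (to-punchIn≢a j))) (sum-replicate N)))
    where
    to-punchIn≢a : ∀ j → ¬ to (punchIn (from a) j) ≡ a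
    to-punchIn≢a j eq = punchInᵢ≢i (from a) j (trans (sym (strictlyInverseʳ _)) (cong from eq))

  Σ-closed : (P : Carrier → Set) → P ε → (∀ x y → P x → P y → P (x ∙ y))
           → ∀ F → (∀ x → P (F x)) → P Σ[ F ]
  Σ-closed P Pε P∙ F PF = go (suc N) (F ∘ to) (PF ∘ to)
    where
    go : ∀ m (t : Fin m → Carrier) → (∀ k → P (t k)) → P (sum t)
    go zero    t Pt = Pε
    go (suc m) t Pt = P∙ _ _ (Pt Fin.zero) (go m (t ∘ Fin.suc) (Pt ∘ Fin.suc))

module PrimeBinomial where
  open import Data.Nat using (_<_; _*_; _∸_; _!)
  open import Data.Nat.Properties
  open import Data.Nat.Divisibility using (_∣_; ∣1⇒≡1; ∣⇒≤; m∣m*n)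
  open import Data.Nat.DivMod using (m*[n/m]≡n)
  open import Data.Nat.Primality using (Prime; euclidsLemma; prime⇒nonTrivial)
  open import Data.Nat.Combinatorics using (_C_; k![n∸k]!∣n!; nCk≡n!/k![n-k]!)

  prime∤factorial : ∀ {p} → Prime p → ∀ m → m < p → ¬ p ∣ m !
  prime∤factorial pp zero m<p p∣1 with ∣1⇒≡1 p∣1
  ... | refl with prime⇒nonTrivial pp
  ... | ()
  prime∤factorial pp (suc m) m<p p∣ with euclidsLemma (suc m) (m !) pp p∣
  ... | inj₁ p∣m+1 = <⇒≱ m<p (∣⇒≤ p∣m+1)
  ... | inj₂ p∣m!  = prime∤factorial pp m (<-trans (n<1+n m) m<p) p∣m!

  -- A prime p divides the binomial coefficient (p choose k) when 0 < k < p,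
  -- since p divides p! = k!(p-k)!·(p choose k) but neither factorial.
  prime∣choose : ∀ {p k} → Prime p → 0 < k → k < p → p ∣ p C k
  prime∣choose {p@(suc p′)} {k} pp 0<k k<p with euclidsLemma (k ! * (p ∸ k) !) (p C k) pp p∣p!
    where
    p∣p! : p ∣ (k ! * (p ∸ k) !) * (p C k)
    p∣p! = subst (p ∣_) (sym (trans (cong ((k ! * (p ∸ k) !) *_) (nCk≡n!/k![n-k]! (<⇒≤ k<p)))
                                    (m*[n/m]≡n {{k !* (p ∸ k) !≢0}} (k![n∸k]!∣n! (<⇒≤ k<p)))))
                 (m∣m*n (p′ !))
  ... | inj₂ p∣C = p∣C
  ... | inj₁ p∣k![p-k]! with euclidsLemma (k !) ((p ∸ k) !) pp p∣k![p-k]!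
  ...   | inj₁ p∣k!     = ⊥-elim (prime∤factorial pp k k<p p∣k!)
  ...   | inj₂ p∣[p-k]! = ⊥-elim (prime∤factorial pp (p ∸ k) (∸-monoʳ-< 0<k (<⇒≤ k<p)) p∣[p-k]!)

module Frobenius (K : Field) where
  open Field K
  open FieldArithmetic K
  open PrimeBinomial using (prime∣choose)
  open ≡-Reasoning
  open import Data.Nat using (s≤s; z≤n)
  open import Data.Nat.Divisibility using (_∣_; divides)
  open import Data.Nat.Primality using (Prime; prime⇒nonTrivial)
  open import Data.Nat.Combinatorics using (_C_; nCn≡1)
  open import Data.Fin using (toℕ; inject₁; fromℕ)
  open import Data.Fin.Properties using (toℕ-inject₁; toℕ-fromℕ; toℕ<n)
  open import Data.Vec.Functional using (init; last; tail)
  open import Algebra.Properties.CommutativeSemiring.Binomial commutativeSemiring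
    using (theorem; binomialTerm)
  open import Algebra.Properties.Semiring.Sum semiring
    using (sum; sum-init-last; sum-cong-≗; sum-replicate-zero)
  open import Algebra.Properties.Semiring.Mult semiring using (×-assoc-*)
  open import Algebra.Properties.Semiring.Exp semiring using () renaming (_^_ to _^ᴿ_)

  ^ᴿ≡^′ : ∀ x n → x ^ᴿ n ≡ x ^′ n
  ^ᴿ≡^′ x zero    = refl
  ^ᴿ≡^′ x (suc n) = cong (x *_) (^ᴿ≡^′ x n)

  multiple-of-char : ∀ {p} k z → p · 1# ≡ 0# → p ∣ k → k · z ≡ 0#
  multiple-of-char {p} k z char (divides c refl) = begin
    (c ℕ.* p) · z                     ≡⟨ cong ((c ℕ.* p) ·_) (sym (*-identityˡ z)) ⟩
    (c ℕ.* p) · (1# * z)              ≡⟨ sym (×-assoc-* (c ℕ.* p) 1# z) ⟩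
    ((c ℕ.* p) · 1#) * z              ≡⟨ cong (_* z) (×1-homo-* c p) ⟩
    ((c · 1#) * (p · 1#)) * z         ≡⟨ cong (λ w → ((c · 1#) * w) * z) char ⟩
    ((c · 1#) * 0#) * z               ≡⟨ cong (_* z) (zeroʳ _) ⟩
    0# * z                            ≡⟨ zeroˡ z ⟩
    0#                                ∎

  -- In the binomial expansion of (x + y)^p all terms but x^p and y^p carry a
  -- coefficient divisible by p.
  frobenius : ∀ {p} → Prime p → p · 1# ≡ 0# → ∀ x y → (x + y) ^′ p ≡ x ^′ p + y ^′ p
  frobenius {zero}  pp with prime⇒nonTrivial pp
  ... | ()
  frobenius {suc zero} pp with prime⇒nonTrivial pp
  ... | ()
  frobenius {p@(suc (suc m))} pp char x y = begin
    (x + y) ^′ p                                      ≡⟨ sym (^ᴿ≡^′ (x + y) p) ⟩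
    (x + y) ^ᴿ p                                      ≡⟨ theorem p x y ⟩
    t Fin.zero + sum (tail t)                         ≡⟨ cong (t Fin.zero +_) (sum-init-last (tail t)) ⟩
    t Fin.zero + (sum (init (tail t)) + last (tail t)) ≡⟨ cong (λ w → t Fin.zero + (w + last (tail t)))
                                                          (trans (sum-cong-≗ middle-vanishes) (sum-replicate-zero (suc m))) ⟩
    t Fin.zero + (0# + last (tail t))                 ≡⟨ cong₂ _+_ first-term (trans (+-identityˡ _) last-term) ⟩
    y ^′ p + x ^′ p                                   ≡⟨ +-comm _ _ ⟩
    x ^′ p + y ^′ p                                   ∎
    where
    t = binomialTerm x y p
    middle-vanishes : ∀ i → init (tail t) i ≡ 0#
    middle-vanishes i = multiple-of-char (p C toℕ (Fin.suc (inject₁ i))) _ char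
      (prime∣choose pp (s≤s z≤n) (subst (λ w → suc w ℕ.< p) (sym (toℕ-inject₁ i)) (s≤s (toℕ<n i))))
    first-term : t Fin.zero ≡ y ^′ p
    first-term = trans (+-identityʳ _) (trans (*-identityˡ _) (^ᴿ≡^′ y p))
    last-term : last (tail t) ≡ x ^′ p
    last-term = begin
      last (tail t)                                   ≡⟨ cong (λ w → (p C w) · ((x ^ᴿ w) * (y ^ᴿ (p ℕ.∸ w)))) (cong suc (toℕ-fromℕ (suc m))) ⟩
      (p C p) · ((x ^ᴿ p) * (y ^ᴿ (p ℕ.∸ p)))         ≡⟨ cong (_· ((x ^ᴿ p) * (y ^ᴿ (p ℕ.∸ p)))) (nCn≡1 p) ⟩
      1 · ((x ^ᴿ p) * (y ^ᴿ (p ℕ.∸ p)))               ≡⟨ +-identityʳ _ ⟩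
      (x ^ᴿ p) * (y ^ᴿ (p ℕ.∸ p))                     ≡⟨ cong₂ (λ w v → w * (y ^ᴿ v)) (^ᴿ≡^′ x p) (ℕP.n∸n≡0 p) ⟩
      (x ^′ p) * 1#                                   ≡⟨ *-identityʳ _ ⟩
      x ^′ p                                          ∎

module FiniteField (K : Field) (N : ℕ) (e : Fin (suc N) ↔ Field.Carrier K) where
  open Field K
  open FieldArithmetic K
  open ≡-Reasoning
  module Additive       = FiniteSum +-commutativeMonoid N e
  module Multiplicative = FiniteSum *-commutativeMonoid N e
  open Additive using (Σ[_])
  open Multiplicative using () renaming (Σ[_] to Π[_])

  -- Translation by 1 permutes K, so Σ (x + 1) = Σ x, i.e. |K|·1 = 0.
  characteristic : suc N · 1# ≡ 0#
  characteristic = +-cancelˡ Σ[ id ] _ _ (begin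
    Σ[ id ] + suc N · 1#            ≡⟨ cong (Σ[ id ] +_) (sym (Additive.Σ-single 0# 1# (λ _ → 1#) (λ _ _ → refl))) ⟩
    Σ[ id ] + Σ[ (λ _ → 1#) ]       ≡⟨ sym (Additive.Σ-∙ id (λ _ → 1#)) ⟩
    Σ[ id ∘ (_+ 1#) ]               ≡⟨ Additive.Σ-reindex (_+ 1#) (_- 1#) (λ x → shift-back x 1#) (λ x → back-shift x 1#) id ⟩
    Σ[ id ]                         ≡⟨ sym (+-identityʳ _) ⟩
    Σ[ id ] + 0#                    ∎)
    where
    shift-back : ∀ x c → (x + c) - c ≡ x
    shift-back = solve 2 (λ x c → (x :+ c) :- c := x) refl
    back-shift : ∀ x c → (x - c) + c ≡ x
    back-shift = solve 2 (λ x c → (x :- c) :+ c := x) refl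

  ·-is-power : ∀ n a → n Multiplicative.· a ≡ a ^′ n
  ·-is-power zero    a = refl
  ·-is-power (suc n) a = cong (a *_) (·-is-power n a)

  -- Fermat's little theorem.  With unitPart replacing 0 by 1, the permutation
  -- x ↦ a·x (a ≠ 0) gives Π unitPart(a·x) = Π unitPart(x), while the left side
  -- is a^N · Π unitPart(x).
  unitPart : Carrier → Carrier
  unitPart x = ifZero x 1# x

  unitPart-nonzero : ∀ x → ¬ unitPart x ≡ 0#
  unitPart-nonzero x with x ≟ 0#
  ... | yes _   = λ 1≡0 → 0≢1 (sym 1≡0)
  ... | no  x≢0 = x≢0

  unitPart-* : ∀ a x → ¬ a ≡ 0# → unitPart (a * x) ≡ ifZero x 1# a * unitPart x
  unitPart-* a x a≢0 = by-cases (x ≟ 0#)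
    where
    by-cases : Dec (x ≡ 0#) → unitPart (a * x) ≡ ifZero x 1# a * unitPart x
    by-cases (yes x≡0) = begin
      unitPart (a * x)                 ≡⟨ ifZero-yes 1# (a * x) (trans (cong (a *_) x≡0) (zeroʳ a)) ⟩
      1#                               ≡⟨ sym (*-identityˡ 1#) ⟩
      1# * 1#                          ≡⟨ sym (cong₂ _*_ (ifZero-yes 1# a x≡0) (ifZero-yes 1# x x≡0)) ⟩
      ifZero x 1# a * unitPart x       ∎
    by-cases (no x≢0) = begin
      unitPart (a * x)                 ≡⟨ ifZero-no 1# (a * x) (*-nonzero a x a≢0 x≢0) ⟩
      a * x                            ≡⟨ sym (cong₂ _*_ (ifZero-no 1# a x≢0) (ifZero-no 1# x x≢0)) ⟩
      ifZero x 1# a * unitPart x       ∎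

  fermat-unit : ∀ a → ¬ a ≡ 0# → a ^′ N ≡ 1#
  fermat-unit a a≢0 = *-cancelˡ Π[ unitPart ] (a ^′ N) 1# Π≢0 (begin
    Π[ unitPart ] * a ^′ N                         ≡⟨ *-comm _ _ ⟩
    a ^′ N * Π[ unitPart ]                         ≡⟨ cong (_* Π[ unitPart ]) (sym Π-scale) ⟩
    Π[ (λ x → ifZero x 1# a) ] * Π[ unitPart ]     ≡⟨ sym (Multiplicative.Σ-∙ (λ x → ifZero x 1# a) unitPart) ⟩
    Π[ (λ x → ifZero x 1# a * unitPart x) ]        ≡⟨ sym (Multiplicative.Σ-cong (λ x → unitPart-* a x a≢0)) ⟩
    Π[ unitPart ∘ (a *_) ]                         ≡⟨ Multiplicative.Σ-reindex (a *_) (a ⁻¹ *_) (cancel (a ⁻¹) a (inverseˡ a a≢0))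
                                                        (cancel a (a ⁻¹) (inverseʳ a a≢0)) unitPart ⟩
    Π[ unitPart ]                                  ≡⟨ sym (*-identityʳ _) ⟩
    Π[ unitPart ] * 1#                             ∎)
    where
    Π≢0 : ¬ Π[ unitPart ] ≡ 0#
    Π≢0 = Multiplicative.Σ-closed (λ z → ¬ z ≡ 0#) (λ 1≡0 → 0≢1 (sym 1≡0)) *-nonzero unitPart unitPart-nonzero
    Π-scale : Π[ (λ x → ifZero x 1# a) ] ≡ a ^′ N
    Π-scale = begin
      Π[ (λ x → ifZero x 1# a) ]   ≡⟨ Multiplicative.Σ-single 0# a (λ x → ifZero x 1# a) (λ x → ifZero-no 1# a) ⟩
      ifZero 0# 1# a * N Multiplicative.· a ≡⟨ cong₂ _*_ (ifZero-yes 1# a refl) (·-is-power N a) ⟩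
      1# * a ^′ N                  ≡⟨ *-identityˡ _ ⟩
      a ^′ N                       ∎
    cancel : ∀ b c → b * c ≡ 1# → ∀ x → b * (c * x) ≡ x
    cancel b c bc≡1 x = trans (sym (*-assoc b c x)) (trans (cong (_* x) bc≡1) (*-identityˡ x))

  fermat : ∀ x → x ^′ suc N ≡ x
  fermat x with x ≟ 0#
  ... | yes x≡0 = trans (cong (_^′ suc N) x≡0) (trans (zeroˡ _) (sym x≡0))
  ... | no  x≢0 = trans (cong (x *_) (fermat-unit x x≢0)) (*-identityʳ x)

module QuadraticExtension (K : Field) (p n : ℕ) (p-prime : Prime p) (N : ℕ)
                          (card : suc N ≡ (p ^ n) ^ 2) (e : Fin (suc N) ↔ Field.Carrier K) where
  open Field K
  open FieldArithmetic K
  open FiniteField K N e using (characteristic; fermat; module Additive)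
  open Additive using (Σ[_])
  open ≡-Reasoning

  q : ℕ
  q = p ^ n

  φ : Carrier → Carrier
  φ x = x ^′ q

  Fq : Carrier → Set
  Fq = InFq K q

  Fq? : ∀ x → Dec (Fq x)
  Fq? x = φ x ≟ x

  -- K has characteristic p: (p·1)^(2n) = |K|·1 = 0, and K has no nilpotents.
  char-p : p · 1# ≡ 0#
  char-p = ^-zero (p · 1#) (n ℕ.* 2) (begin
    (p · 1#) ^′ (n ℕ.* 2)   ≡⟨ sym (·1-^ p (n ℕ.* 2)) ⟩
    (p ^ (n ℕ.* 2)) · 1#    ≡⟨ cong (_· 1#) (trans (sym (ℕP.^-*-assoc p n 2)) (sym card)) ⟩
    suc N · 1#              ≡⟨ characteristic ⟩
    0#                      ∎)

  -- φ is a ring endomorphism: additivity iterates the Frobenius identity.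
  φ-+ : ∀ x y → φ (x + y) ≡ φ x + φ y
  φ-+ = frobenius-iterate n
    where
    open Frobenius K using (frobenius)
    ^-p^suc : ∀ x m → x ^′ (p ^ suc m) ≡ (x ^′ (p ^ m)) ^′ p
    ^-p^suc x m = trans (cong (x ^′_) (ℕP.*-comm p (p ^ m))) (^-* x (p ^ m) p)
    frobenius-iterate : ∀ m x y → (x + y) ^′ (p ^ m) ≡ x ^′ (p ^ m) + y ^′ (p ^ m)
    frobenius-iterate zero    x y = trans (*-identityʳ _) (sym (cong₂ _+_ (*-identityʳ x) (*-identityʳ y)))
    frobenius-iterate (suc m) x y = begin
      (x + y) ^′ (p ^ suc m)                       ≡⟨ ^-p^suc (x + y) m ⟩
      ((x + y) ^′ (p ^ m)) ^′ p                    ≡⟨ cong (_^′ p) (frobenius-iterate m x y) ⟩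
      (x ^′ (p ^ m) + y ^′ (p ^ m)) ^′ p           ≡⟨ frobenius p-prime char-p _ _ ⟩
      (x ^′ (p ^ m)) ^′ p + (y ^′ (p ^ m)) ^′ p    ≡⟨ sym (cong₂ _+_ (^-p^suc x m) (^-p^suc y m)) ⟩
      x ^′ (p ^ suc m) + y ^′ (p ^ suc m)          ∎

  φ-* : ∀ x y → φ (x * y) ≡ φ x * φ y
  φ-* x y = *-^ x y q

  φ-0 : φ 0# ≡ 0#
  φ-0 = trans (cong (0# ^′_) (sym (ℕP.suc-pred q {{q≢0}}))) (zeroˡ _)
    where
    q≢0 = ℕP.m^n≢0 p n {{prime⇒nonZero p-prime}}

  φ-neg : ∀ x → φ (- x) ≡ - φ x
  φ-neg x = +-inverseʳ-unique (φ x) (φ (- x))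
    (trans (sym (φ-+ x (- x))) (trans (cong φ (-‿inverseʳ x)) φ-0))

  φ-⁻¹ : ∀ x → ¬ x ≡ 0# → φ (x ⁻¹) ≡ φ x ⁻¹
  φ-⁻¹ x x≢0 = inverse-unique (φ x) (φ (x ⁻¹))
    (trans (sym (φ-* x (x ⁻¹))) (trans (cong φ (inverseʳ x x≢0)) (1-^ q)))

  -- φ is an involution, because q·q = |K| and x^|K| = x.
  φ-involutive : ∀ x → φ (φ x) ≡ x
  φ-involutive x = begin
    (x ^′ q) ^′ q      ≡⟨ sym (^-* x q q) ⟩
    x ^′ (q ℕ.* q)     ≡⟨ cong (x ^′_) (trans (cong (q ℕ.*_) (sym (ℕP.*-identityʳ q))) (sym card)) ⟩
    x ^′ suc N         ≡⟨ fermat x ⟩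
    x                  ∎

  Fq-+ : ∀ x y → Fq x → Fq y → Fq (x + y)
  Fq-+ x y x∈ y∈ = trans (φ-+ x y) (cong₂ _+_ x∈ y∈)

  Fq-- : ∀ x y → Fq x → Fq y → Fq (x - y)
  Fq-- x y x∈ y∈ = trans (φ-+ x (- y)) (cong₂ _+_ x∈ (trans (φ-neg y) (cong -_ y∈)))

  Fq-* : ∀ x y → Fq x → Fq y → Fq (x * y)
  Fq-* x y x∈ y∈ = trans (φ-* x y) (cong₂ _*_ x∈ y∈)

  Fq-⁻¹ : ∀ x → ¬ x ≡ 0# → Fq x → Fq (x ⁻¹)
  Fq-⁻¹ x x≢0 x∈ = trans (φ-⁻¹ x x≢0) (cong _⁻¹ x∈)

  Fq-1 : Fq 1#
  Fq-1 = 1-^ q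

  trace∈Fq : ∀ ρ → Fq (ρ + φ ρ)
  trace∈Fq ρ = trans (φ-+ ρ (φ ρ)) (trans (cong (φ ρ +_) (φ-involutive ρ)) (+-comm _ _))

  norm∈Fq : ∀ ρ → Fq (ρ * φ ρ)
  norm∈Fq ρ = trans (φ-* ρ (φ ρ)) (trans (cong (φ ρ *_) (φ-involutive ρ)) (*-comm _ _))

  φ-∉Fq : ∀ ρ → ¬ Fq ρ → ¬ Fq (φ ρ)
  φ-∉Fq ρ ρ∉ φρ∈ = ρ∉ (sym (trans (sym (φ-involutive ρ)) φρ∈))

  ∉Fq-nonzero : ∀ ρ → ¬ Fq ρ → ¬ ρ ≡ 0#
  ∉Fq-nonzero ρ ρ∉ ρ≡0 = ρ∉ (trans (cong φ ρ≡0) (trans φ-0 (sym ρ≡0)))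

  -- Case distinction on membership in F_q; the branch for members may use the
  -- membership proof, which is unique since K has decidable equality.
  ifFq : {B : Set} (x : Carrier) → (Fq x → B) → B → B
  ifFq x b c with Fq? x
  ... | yes x∈ = b x∈
  ... | no  _  = c

  ifFq-yes : ∀ {B : Set} x (b : Fq x → B) c (x∈ : Fq x) → ifFq x b c ≡ b x∈
  ifFq-yes x b c x∈ with Fq? x
  ... | yes x∈′ = cong b (Decidable⇒UIP.≡-irrelevant _≟_ x∈′ x∈)
  ... | no  x∉  = ⊥-elim (x∉ x∈)

  ifFq-no : ∀ {B : Set} x (b : Fq x → B) c → ¬ Fq x → ifFq x b c ≡ c
  ifFq-no x b c x∉ with Fq? x
  ... | yes x∈ = ⊥-elim (x∉ x∈)
  ... | no  _  = refl

  -- S F = Σ_{x ∈ F_q} F(x), the sum over K of F restricted to F_q.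
  restrict : (Carrier → Carrier) → Carrier → Carrier
  restrict F x = ifFq x (λ _ → F x) 0#

  S : (Carrier → Carrier) → Carrier
  S F = Σ[ restrict F ]

  S-cong : ∀ F G → (∀ x → Fq x → F x ≡ G x) → S F ≡ S G
  S-cong F G F≡G = Additive.Σ-cong pointwise
    where
    pointwise : ∀ x → restrict F x ≡ restrict G x
    pointwise x with Fq? x
    ... | yes x∈ = F≡G x x∈
    ... | no  _  = refl

  S-+ : ∀ F G → S (λ x → F x + G x) ≡ S F + S G
  S-+ F G = trans (Additive.Σ-cong pointwise) (Additive.Σ-∙ (restrict F) (restrict G))
    where
    pointwise : ∀ x → restrict (λ x → F x + G x) x ≡ restrict F x + restrict G x
    pointwise x with Fq? x
    ... | yes _ = refl
    ... | no  _ = sym (+-identityˡ 0#)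

  S-* : ∀ c F → S (λ x → c * F x) ≡ c * S F
  S-* c F = trans (Additive.Σ-cong pointwise) (sym (*-distribˡ-sum c (restrict F ∘ Inverse.to e)))
    where
    open import Algebra.Properties.Semiring.Sum semiring using (*-distribˡ-sum)
    pointwise : ∀ x → restrict (λ x → c * F x) x ≡ c * restrict F x
    pointwise x with Fq? x
    ... | yes _ = refl
    ... | no  _ = sym (zeroʳ c)

  S-point : ∀ c → S (λ x → ifZero x c 0#) ≡ c
  S-point c = begin
    S (λ x → ifZero x c 0#)                              ≡⟨ Additive.Σ-single 0# 0# _ off-zero ⟩
    restrict (λ x → ifZero x c 0#) 0# + N · 0#           ≡⟨ cong₂ _+_ at-zero (·-0 N) ⟩
    c + 0#                                               ≡⟨ +-identityʳ c ⟩
    c                                                    ∎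
    where
    off-zero : ∀ x → ¬ x ≡ 0# → restrict (λ x → ifZero x c 0#) x ≡ 0#
    off-zero x x≢0 with Fq? x
    ... | yes _ = ifZero-no c 0# x≢0
    ... | no  _ = refl
    at-zero : restrict (λ x → ifZero x c 0#) 0# ≡ c
    at-zero = trans (ifFq-yes 0# _ 0# φ-0) (ifZero-yes c 0# refl)
    ·-0 : ∀ m → m · 0# ≡ 0#
    ·-0 zero    = refl
    ·-0 (suc m) = trans (+-identityˡ _) (·-0 m)

  -- Reindexing by a permutation g of F_q: extend g by the identity off F_q to
  -- a bijection of K and reindex the sum over K.
  S-permute : (g : Carrier → Carrier)
            → (∀ x → Fq x → Fq (g x))
            → (∀ x y → Fq x → Fq y → g x ≡ g y → x ≡ y)
            → (∀ y → Fq y → ∃ λ x → Fq x × g x ≡ y)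
            → ∀ F → S (F ∘ g) ≡ S F
  S-permute g g∈ g-injective g-onto F =
    trans (Additive.Σ-cong pointwise) (Additive.Σ-reindex extend retract retract-extend extend-retract (restrict F))
    where
    extend : Carrier → Carrier
    extend x = ifFq x (λ _ → g x) x
    retract : Carrier → Carrier
    retract y = ifFq y (λ y∈ → proj₁ (g-onto y y∈)) y

    retract-spec : ∀ y → Fq y → Fq (retract y) × g (retract y) ≡ y
    retract-spec y y∈ = subst (λ x → Fq x × g x ≡ y) (sym (ifFq-yes y _ y y∈)) (proj₂ (g-onto y y∈))

    retract-extend : ∀ x → retract (extend x) ≡ x
    retract-extend x = by-cases (Fq? x)
      where
      by-cases : Dec (Fq x) → retract (extend x) ≡ x
      by-cases (yes x∈) = trans (cong retract (ifFq-yes x (λ _ → g x) x x∈))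
                                (g-injective _ x (proj₁ spec) x∈ (proj₂ spec))
        where spec = retract-spec (g x) (g∈ x x∈)
      by-cases (no x∉) = trans (cong retract (ifFq-no x _ x x∉)) (ifFq-no x _ x x∉)

    extend-retract : ∀ y → extend (retract y) ≡ y
    extend-retract y = by-cases (Fq? y)
      where
      by-cases : Dec (Fq y) → extend (retract y) ≡ y
      by-cases (yes y∈) = trans (ifFq-yes _ _ _ (proj₁ spec)) (proj₂ spec)
        where spec = retract-spec y y∈
      by-cases (no y∉) = trans (cong extend (ifFq-no y _ y y∉)) (ifFq-no y _ y y∉)

    pointwise : ∀ x → restrict (F ∘ g) x ≡ restrict F (extend x)
    pointwise x with Fq? x
    ... | yes x∈ = sym (ifFq-yes (g x) _ 0# (g∈ x x∈))
    ... | no  x∉ = sym (ifFq-no x _ 0# x∉)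

  -- Translation by 1 permutes F_q, so Σ_{x ∈ F_q} 1 = 0.
  S-one : S (λ _ → 1#) ≡ 0#
  S-one = +-cancelˡ (S id) _ _ (begin
    S id + S (λ _ → 1#)      ≡⟨ sym (S-+ id (λ _ → 1#)) ⟩
    S (id ∘ (_+ 1#))         ≡⟨ S-permute (_+ 1#) (λ x x∈ → Fq-+ x 1# x∈ Fq-1) shift-injective shift-onto id ⟩
    S id                     ≡⟨ sym (+-identityʳ _) ⟩
    S id + 0#                ∎)
    where
    shift-injective : ∀ x y → Fq x → Fq y → x + 1# ≡ y + 1# → x ≡ y
    shift-injective x y _ _ = +-cancelʳ 1# x y
    shift-onto : ∀ y → Fq y → ∃ λ x → Fq x × x + 1# ≡ y
    shift-onto y y∈ = y - 1# , Fq-- y 1# y∈ Fq-1 , solve 2 (λ y o → (y :- o) :+ o := y) refl y 1#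

  module Möbius (ρ ρ′ : Carrier) (ρ∉ : ¬ Fq ρ) (ρ′≢0 : ¬ ρ′ ≡ 0#)
                (u∈ : Fq (ρ + ρ′)) (v∈ : Fq (ρ * ρ′)) where
    u v : Carrier
    u = ρ + ρ′
    v = ρ * ρ′

    v≢0 : ¬ v ≡ 0#
    v≢0 = *-nonzero ρ ρ′ (∉Fq-nonzero ρ ρ∉) ρ′≢0

    σ τ : Carrier → Carrier
    σ x = ifZero x u (u - v * x ⁻¹)
    τ y = ifZero (u - y) 0# (v * (u - y) ⁻¹)

    u-[u-w] : ∀ w → u - (u - w) ≡ w
    u-[u-w] = solve 2 (λ u w → u :- (u :- w) := w) refl u

    τσ : ∀ x → τ (σ x) ≡ x
    τσ x with x ≟ 0#
    ... | yes x≡0 = trans (ifZero-yes 0# _ (-‿inverseʳ u)) (sym x≡0)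
    ... | no  x≢0 = begin
      τ (u - v * x ⁻¹)              ≡⟨ ifZero-no 0# _ (λ eq → v/x≢0 (trans (sym (u-[u-w] _)) eq)) ⟩
      v * (u - (u - v * x ⁻¹)) ⁻¹   ≡⟨ cong (λ w → v * w ⁻¹) (u-[u-w] _) ⟩
      v * (v * x ⁻¹) ⁻¹             ≡⟨ *-⁻¹-cancel v (x ⁻¹) v≢0 (⁻¹-nonzero x x≢0) ⟩
      x ⁻¹ ⁻¹                       ≡⟨ ⁻¹-involutive x x≢0 ⟩
      x                             ∎
      where v/x≢0 = *-nonzero v (x ⁻¹) v≢0 (⁻¹-nonzero x x≢0)

    στ : ∀ y → σ (τ y) ≡ y
    στ y with (u - y) ≟ 0#
    ... | yes u-y≡0 = trans (ifZero-yes u _ refl) (x∙y⁻¹≈ε⇒x≈y u y u-y≡0)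
    ... | no  u-y≢0 = begin
      σ (v * (u - y) ⁻¹)                ≡⟨ ifZero-no u _ (*-nonzero v _ v≢0 (⁻¹-nonzero _ u-y≢0)) ⟩
      u - v * (v * (u - y) ⁻¹) ⁻¹       ≡⟨ cong (λ w → u - w) (*-⁻¹-cancel v _ v≢0 (⁻¹-nonzero _ u-y≢0)) ⟩
      u - (u - y) ⁻¹ ⁻¹                 ≡⟨ cong (λ w → u - w) (⁻¹-involutive _ u-y≢0) ⟩
      u - (u - y)                       ≡⟨ u-[u-w] y ⟩
      y                                 ∎

    σ∈ : ∀ x → Fq x → Fq (σ x)
    σ∈ x x∈ with x ≟ 0#
    ... | yes _   = u∈
    ... | no  x≢0 = Fq-- u _ u∈ (Fq-* v _ v∈ (Fq-⁻¹ x x≢0 x∈))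

    τ∈ : ∀ y → Fq y → Fq (τ y)
    τ∈ y y∈ with (u - y) ≟ 0#
    ... | yes _     = φ-0
    ... | no  u-y≢0 = Fq-* v _ v∈ (Fq-⁻¹ _ u-y≢0 (Fq-- u y u∈ y∈))

    -- At x = 0 the left side is ρ'/ρ' = 1 while 1 + ρ/(0 - ρ) = 0.
    shift-at-zero : ∀ x → x ≡ 0# → ρ′ * (σ x - ρ) ⁻¹ ≡ (1# + ρ * (x - ρ) ⁻¹) + ifZero x 1# 0#
    shift-at-zero x x≡0 = begin
      ρ′ * (σ x - ρ) ⁻¹                       ≡⟨ cong (λ w → ρ′ * (w - ρ) ⁻¹) (ifZero-yes u _ x≡0) ⟩
      ρ′ * (u - ρ) ⁻¹                         ≡⟨ cong (λ w → ρ′ * w ⁻¹) (solve 2 (λ r r′ → (r :+ r′) :- r := r′) refl ρ ρ′) ⟩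
      ρ′ * ρ′ ⁻¹                              ≡⟨ inverseʳ ρ′ ρ′≢0 ⟩
      1#                                      ≡⟨ sym (+-identityˡ 1#) ⟩
      0# + 1#                                 ≡⟨ sym (cong₂ _+_ vanishes (ifZero-yes 1# 0# x≡0)) ⟩
      (1# + ρ * (x - ρ) ⁻¹) + ifZero x 1# 0#  ∎
      where
      ρ≢0 = ∉Fq-nonzero ρ ρ∉
      vanishes : 1# + ρ * (x - ρ) ⁻¹ ≡ 0#
      vanishes = begin
        1# + ρ * (x - ρ) ⁻¹      ≡⟨ cong (λ w → 1# + ρ * (w - ρ) ⁻¹) x≡0 ⟩
        1# + ρ * (0# - ρ) ⁻¹     ≡⟨ cong (λ w → 1# + ρ * w ⁻¹) (+-identityˡ (- ρ)) ⟩
        1# + ρ * (- ρ) ⁻¹        ≡⟨ cong (λ w → 1# + ρ * w) (⁻¹-neg ρ ρ≢0) ⟩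
        1# + ρ * - (ρ ⁻¹)        ≡⟨ solve 3 (λ o r s → o :+ r :* (:- s) := o :- r :* s) refl 1# ρ (ρ ⁻¹) ⟩
        1# - ρ * ρ ⁻¹            ≡⟨ cong (λ w → 1# - w) (inverseʳ ρ ρ≢0) ⟩
        1# - 1#                  ≡⟨ -‿inverseʳ 1# ⟩
        0#                       ∎

    -- For x ≠ 0 in F_q:  σ(x) - ρ = ρ'·(x - ρ)/x,  so  ρ'/(σ(x) - ρ) = x/(x - ρ).
    shift-away-from-zero : ∀ x → Fq x → ¬ x ≡ 0#
                         → ρ′ * (σ x - ρ) ⁻¹ ≡ (1# + ρ * (x - ρ) ⁻¹) + ifZero x 1# 0#
    shift-away-from-zero x x∈ x≢0 = begin
      ρ′ * (σ x - ρ) ⁻¹                       ≡⟨ cong (λ w → ρ′ * w ⁻¹) σx-ρ ⟩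
      ρ′ * (ρ′ * ((x - ρ) * x ⁻¹)) ⁻¹         ≡⟨ *-⁻¹-cancel ρ′ _ ρ′≢0 (*-nonzero _ _ x-ρ≢0 (⁻¹-nonzero x x≢0)) ⟩
      ((x - ρ) * x ⁻¹) ⁻¹                     ≡⟨ ⁻¹-* (x - ρ) (x ⁻¹) x-ρ≢0 (⁻¹-nonzero x x≢0) ⟩
      (x - ρ) ⁻¹ * x ⁻¹ ⁻¹                    ≡⟨ cong ((x - ρ) ⁻¹ *_) (⁻¹-involutive x x≢0) ⟩
      (x - ρ) ⁻¹ * x                          ≡⟨ solve 3 (λ d x r → d :* x := d :* (x :- r) :+ r :* d) refl ((x - ρ) ⁻¹) x ρ ⟩
      (x - ρ) ⁻¹ * (x - ρ) + ρ * (x - ρ) ⁻¹   ≡⟨ cong (_+ ρ * (x - ρ) ⁻¹) (inverseˡ (x - ρ) x-ρ≢0) ⟩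
      1# + ρ * (x - ρ) ⁻¹                     ≡⟨ sym (+-identityʳ _) ⟩
      (1# + ρ * (x - ρ) ⁻¹) + 0#              ≡⟨ cong ((1# + ρ * (x - ρ) ⁻¹) +_) (sym (ifZero-no 1# 0# x≢0)) ⟩
      (1# + ρ * (x - ρ) ⁻¹) + ifZero x 1# 0#  ∎
      where
      x-ρ≢0 : ¬ x - ρ ≡ 0#
      x-ρ≢0 x-ρ≡0 = ρ∉ (subst Fq (x∙y⁻¹≈ε⇒x≈y x ρ x-ρ≡0) x∈)
      σx-ρ : σ x - ρ ≡ ρ′ * ((x - ρ) * x ⁻¹)
      σx-ρ = begin
        σ x - ρ                                 ≡⟨ cong (_- ρ) (ifZero-no u _ x≢0) ⟩
        (u - v * x ⁻¹) - ρ                      ≡⟨ solve 3 (λ r r′ y → ((r :+ r′) :- (r :* r′) :* y) :- r := r′ :- r′ :* (r :* y)) refl ρ ρ′ (x ⁻¹) ⟩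
        ρ′ - ρ′ * (ρ * x ⁻¹)                    ≡⟨ cong (_- ρ′ * (ρ * x ⁻¹)) (sym (trans (cong (ρ′ *_) (inverseʳ x x≢0)) (*-identityʳ ρ′))) ⟩
        ρ′ * (x * x ⁻¹) - ρ′ * (ρ * x ⁻¹)       ≡⟨ solve 4 (λ r′ x y r → r′ :* (x :* y) :- r′ :* (r :* y) := r′ :* ((x :- r) :* y)) refl ρ′ x (x ⁻¹) ρ ⟩
        ρ′ * ((x - ρ) * x ⁻¹)                   ∎

    shift : ∀ x → Fq x → ρ′ * (σ x - ρ) ⁻¹ ≡ (1# + ρ * (x - ρ) ⁻¹) + ifZero x 1# 0#
    shift x x∈ = by-cases (x ≟ 0#)
      where
      by-cases : Dec (x ≡ 0#) → ρ′ * (σ x - ρ) ⁻¹ ≡ (1# + ρ * (x - ρ) ⁻¹) + ifZero x 1# 0#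
      by-cases (yes x≡0) = shift-at-zero x x≡0
      by-cases (no  x≢0) = shift-away-from-zero x x∈ x≢0

  T : Carrier → Carrier
  T ρ = S (λ x → (x - ρ) ⁻¹)

  -- Summing the Möbius identity over F_q:  ρ'·T(ρ) = Σ 1 + ρ·T(ρ) + 1 = ρ·T(ρ) + 1.
  T-evaluation : ∀ ρ ρ′ → ¬ Fq ρ → ¬ ρ′ ≡ 0# → Fq (ρ + ρ′) → Fq (ρ * ρ′) → T ρ * (ρ′ - ρ) ≡ 1#
  T-evaluation ρ ρ′ ρ∉ ρ′≢0 u∈ v∈ = begin
    T ρ * (ρ′ - ρ)             ≡⟨ solve 3 (λ t r r′ → t :* (r′ :- r) := r′ :* t :- r :* t) refl (T ρ) ρ ρ′ ⟩
    ρ′ * T ρ - ρ * T ρ         ≡⟨ cong (_- ρ * T ρ) ρ′T ⟩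
    (ρ * T ρ + 1#) - ρ * T ρ   ≡⟨ solve 2 (λ a o → (a :+ o) :- a := o) refl (ρ * T ρ) 1# ⟩
    1#                         ∎
    where
    open Möbius ρ ρ′ ρ∉ ρ′≢0 u∈ v∈
    h : Carrier → Carrier
    h x = (x - ρ) ⁻¹
    σ-injective : ∀ x y → Fq x → Fq y → σ x ≡ σ y → x ≡ y
    σ-injective x y _ _ σx≡σy = trans (sym (τσ x)) (trans (cong τ σx≡σy) (τσ y))
    ρ′T : ρ′ * T ρ ≡ ρ * T ρ + 1#
    ρ′T = begin
      ρ′ * T ρ                                           ≡⟨ cong (ρ′ *_) (sym (S-permute σ σ∈ σ-injective (λ y y∈ → τ y , τ∈ y y∈ , στ y) h)) ⟩
      ρ′ * S (h ∘ σ)                                     ≡⟨ sym (S-* ρ′ (h ∘ σ)) ⟩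
      S (λ x → ρ′ * h (σ x))                             ≡⟨ S-cong _ _ shift ⟩
      S (λ x → (1# + ρ * h x) + ifZero x 1# 0#)          ≡⟨ S-+ (λ x → 1# + ρ * h x) (λ x → ifZero x 1# 0#) ⟩
      S (λ x → 1# + ρ * h x) + S (λ x → ifZero x 1# 0#)  ≡⟨ cong₂ _+_ (S-+ (λ _ → 1#) (λ x → ρ * h x)) (S-point 1#) ⟩
      (S (λ _ → 1#) + S (λ x → ρ * h x)) + 1#            ≡⟨ cong₂ (λ a b → (a + b) + 1#) S-one (S-* ρ h) ⟩
      (0# + ρ * T ρ) + 1#                                ≡⟨ cong (_+ 1#) (+-identityˡ _) ⟩
      ρ * T ρ + 1#                                       ∎

  -- For x ∈ F_q the poles r, r^q ∉ F_q are avoided, so fMap acts on F_q as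
  -- the affine expression f.
  module PermutationRational (r b : Carrier) (r∉ : ¬ Fq r) where
    f : Carrier → Carrier
    f x = x + b * (x - r) ⁻¹ + φ b * (x - φ r) ⁻¹

    fMap-on-Fq : ∀ x → Fq x → fMap K q r b (just x) ≡ just (f x)
    fMap-on-Fq x x∈ with x ≟ r | x ≟ φ r
    ... | yes x≡r | _        = ⊥-elim (r∉ (subst Fq x≡r x∈))
    ... | no _    | yes x≡φr = ⊥-elim (φ-∉Fq r r∉ (subst Fq x≡φr x∈))
    ... | no _    | no _     = refl

    -- A permutation of P¹(F_q) fixing ∞ restricts to a permutation of F_q.
    module _ (perm : IsPermutationP1Fq K q (fMap K q r b)) where
      f∈ : ∀ x → Fq x → Fq (f x)
      f∈ x x∈ = subst (InP1Fq K q) (fMap-on-Fq x x∈) (proj₁ perm (just x) x∈)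

      f-injective : ∀ x y → Fq x → Fq y → f x ≡ f y → x ≡ y
      f-injective x y x∈ y∈ fx≡fy = just-injective (proj₁ (proj₂ perm) (just x) (just y) x∈ y∈
        (trans (fMap-on-Fq x x∈) (trans (cong just fx≡fy) (sym (fMap-on-Fq y y∈)))))

      f-onto : ∀ y → Fq y → ∃ λ x → Fq x × f x ≡ y
      f-onto y y∈ with proj₂ (proj₂ perm) (just y) y∈
      ... | nothing , _  , ()
      ... | just x  , x∈ , fx≡y = x , x∈ , just-injective (trans (sym (fMap-on-Fq x x∈)) fx≡y)

  -- The theorem inside K: summing f over F_q gives b·T(r) + b^q·T(r^q) = 0,
  -- and multiplying by r^q - r with T(r)(r^q - r) = 1 = T(r^q)(r - r^q)
  -- turns this into b - b^q = 0.
  permutation⇒b∈Fq : ∀ r b → ¬ Fq r → IsPermutationP1Fq K q (fMap K q r b) → Fq b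
  permutation⇒b∈Fq r b r∉ perm = sym (x∙y⁻¹≈ε⇒x≈y b (φ b) b-φb≡0)
    where
    open PermutationRational r b r∉
    T-r : T r * (φ r - r) ≡ 1#
    T-r = T-evaluation r (φ r) r∉ (∉Fq-nonzero (φ r) (φ-∉Fq r r∉)) (trace∈Fq r) (norm∈Fq r)
    T-φr : T (φ r) * (r - φ r) ≡ 1#
    T-φr = T-evaluation (φ r) r (φ-∉Fq r r∉) (∉Fq-nonzero r r∉)
             (subst Fq (+-comm r (φ r)) (trace∈Fq r)) (subst Fq (*-comm r (φ r)) (norm∈Fq r))

    S-f : S f ≡ S id + (b * T r + φ b * T (φ r))
    S-f = begin
      S f                                                  ≡⟨ S-+ (λ x → x + b * (x - r) ⁻¹) (λ x → φ b * (x - φ r) ⁻¹) ⟩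
      S (λ x → x + b * (x - r) ⁻¹) + S (λ x → φ b * (x - φ r) ⁻¹)
                                                           ≡⟨ cong₂ _+_ (S-+ id (λ x → b * (x - r) ⁻¹)) (S-* (φ b) (λ x → (x - φ r) ⁻¹)) ⟩
      (S id + S (λ x → b * (x - r) ⁻¹)) + φ b * T (φ r)    ≡⟨ cong (λ z → (S id + z) + φ b * T (φ r)) (S-* b (λ x → (x - r) ⁻¹)) ⟩
      (S id + b * T r) + φ b * T (φ r)                     ≡⟨ +-assoc (S id) _ _ ⟩
      S id + (b * T r + φ b * T (φ r))                     ∎

    T-relation : b * T r + φ b * T (φ r) ≡ 0#
    T-relation = +-cancelˡ (S id) _ _ (begin
      S id + (b * T r + φ b * T (φ r))   ≡⟨ sym S-f ⟩
      S (id ∘ f)                         ≡⟨ S-permute f (f∈ perm) (f-injective perm) (f-onto perm) id ⟩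
      S id                               ≡⟨ sym (+-identityʳ _) ⟩
      S id + 0#                          ∎)

    b-φb≡0 : b - φ b ≡ 0#
    b-φb≡0 = begin
      b - φ b                                              ≡⟨ sym (cong₂ _-_ (*-identityʳ b) (*-identityʳ (φ b))) ⟩
      b * 1# - φ b * 1#                                    ≡⟨ cong₂ (λ s t → b * s - φ b * t) (sym T-r) (sym T-φr) ⟩
      b * (T r * (φ r - r)) - φ b * (T (φ r) * (r - φ r))  ≡⟨ solve 6 (λ b c t₁ t₂ r s → b :* (t₁ :* (s :- r)) :- c :* (t₂ :* (r :- s))
                                                                              := (b :* t₁ :+ c :* t₂) :* (s :- r))
                                                                refl b (φ b) (T r) (T (φ r)) r (φ r) ⟩
      (b * T r + φ b * T (φ r)) * (φ r - r)                ≡⟨ cong (_* (φ r - r)) T-relation ⟩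
      0# * (φ r - r)                                       ≡⟨ zeroˡ _ ⟩
      0#                                                   ∎

enumeration : ∀ {A : Set} m → Fin m ↔ A → A → Σ ℕ λ N → suc N ≡ m × (Fin (suc N) ↔ A)
enumeration zero    e a with Inverse.from e a
... | ()
enumeration (suc N) e _ = N , refl , e

-- The argument does not use the hypothesis n ≥ 1; b ≠ 0 is passed through.
lemma3p1 : (q : ℕ) → IsPrimePower q → (K : Field) → HasCard K (q ^ 2)
    → (r b : Field.Carrier K)
    → ¬ InFq K q r
    → ¬ (b ≡ Field.0# K)
    → IsPermutationP1Fq K q (fMap K q r b)
    → InFq K q b × ¬ (b ≡ Field.0# K)
lemma3p1 q (p , n , p-prime , _ , refl) K card r b r∉ b≢0 perm
  with enumeration (q ^ 2) card (Field.0# K)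
... | N , |K|≡q² , e = QuadraticExtension.permutation⇒b∈Fq K p n p-prime N |K|≡q² e r b r∉ perm , b≢0
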